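{- Let $(G_j)_{j\in\mathbb Z}$ and $(H_j)_{j\in\mathbb Z}$ be gibonacci sequences. For all integers $k$, $r$, $s$, $$\begin{aligned} &5G_kH_{k+s-r}-(G_{k+1}+G_{k-1})(H_{k+s-r+1}+H_{k+s-r-1})\\ &=(-1)^{k-r+1}2(G_{r+1}+G_{r-1})(H_{s+1}+H_{s-1})\\ &\quad+(-1)^{k-r}2\Big(G_0(H_{r+s}+H_{r+s-2})+G_1(H_{r+s+1}+H_{r+s-1})\Big). \end{aligned}$$
   Context: A gibonacci sequence is a sequence $(G_j)_{j\in\mathbb Z}$ with arbitrary initial values $G_0,G_1$, not both zero, satisfying $G_j=G_{j-1}+G_{j-2}$ for all integers $j$; similarly for $(H_j)$ with seeds $H_0,H_1$. -}

module Defs where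

open import Level using (Level)
open import Data.Nat using (ℕ)
import Data.Nat as ℕ
open import Data.Integer using (ℤ; ∣_∣; +_) renaming (_-_ to _-ℤ_)
open import Data.Product using (_×_)
open import Relation.Nullary using (¬_)
open import Algebra.Bundles using (CommutativeRing; Semiring)
import Algebra.Definitions.RawSemiring as RS

module _ {c ℓ : Level} (R : CommutativeRing c ℓ) where
  open CommutativeRing R renaming (_+_ to _+R_)

  IsGibonacci : (ℤ → Carrier) → Set ℓ
  IsGibonacci G =
    ¬ (G (+ 0) ≈ 0# × G (+ 1) ≈ 0#) ×
    (∀ (j : ℤ) → G j ≈ G (j -ℤ + 1) +R G (j -ℤ + 2))

  nat : ℕ → Carrier
  nat n = RS._×_ (Semiring.rawSemiring semiring) n 1#

  negOnePow : ℤ → Carrier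
  negOnePow n with ∣ n ∣ ℕ.% 2
  ... | ℕ.zero = 1#
  ... | ℕ.suc _ = - 1#

-- Write L_j = G_(j+1) + G_(j-1), and L' likewise for H, so that (L_j + G_j √5)/2 = φ^j (L_0 + G_0 √5)/2.
-- Then 5 G_j H_m − L_j L'_m is a polarised norm form and changes sign when j and m both increase by one
-- (N(φ) = −1); this reduces the left-hand side to (−1)^(k−r) times its value at (r, s). A direct computation
-- from the recurrence writes that value as 2 (G_r L'_(s−1) + G_(r+1) L'_s) − 2 L_r L'_s, and
-- G_a L'_b + G_(a+1) L'_(b+1) depends only on a + b, which moves the first term to the seeds G_0, G_1.
module Submission where

open import Defs
open import Level using (Level)
open import Data.Integer using (ℤ; +_) renaming (_+_ to _+ℤ_; _-_ to _-ℤ_)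
open import Algebra.Bundles using (CommutativeRing)

open import Data.Nat as ℕ using (ℕ; zero; suc)
import Data.Nat.Properties as ℕ
open import Data.Integer as ℤ using (-[1+_]; _⊖_; _◃_)
import Data.Integer.Properties as ℤ
open import Data.Integer.Tactic.RingSolver using (solve-∀)
open import Data.Maybe using (Maybe; just; nothing)
open import Data.Product using (proj₂)
open import Data.Sign as Sign using (Sign)
open import Relation.Nullary using (yes; no)
open import Relation.Binary.PropositionalEquality as ≡ using (_≡_)

module IntegerCoefficients {c ℓ} (R : CommutativeRing c ℓ) where
  open CommutativeRing R
  open import Algebra.Properties.Ring ring using (-‿involutive; -‿+-comm; -1*x≈-x; -0#≈0#)
  open import Algebra.Properties.Semiring.Mult semiring using (_×_; ×-homo-+; ×1-homo-*)
  open import Algebra.Solver.Ring.AlmostCommutativeRing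
    using (fromCommutativeRing; _-Raw-AlmostCommutative⟶_)
  open import Algebra.Properties.CommutativeSemigroup *-commutativeSemigroup using (interchange)
  open import Relation.Binary.Reasoning.Setoid setoid

  fromℤ : ℤ → Carrier
  fromℤ (+ n) = n × 1#
  fromℤ -[1+ n ] = - (suc n × 1#)

  private
    [1+x]-[1+y]≈x-y : ∀ x y → (1# + x) - (1# + y) ≈ x - y
    [1+x]-[1+y]≈x-y x y = begin
      (1# + x) + - (1# + y)     ≈⟨ +-congˡ (-‿+-comm 1# y) ⟨
      (1# + x) + (- 1# + - y)   ≈⟨ +-congʳ (+-comm 1# x) ⟩
      (x + 1#) + (- 1# + - y)   ≈⟨ +-assoc x 1# _ ⟩
      x + (1# + (- 1# + - y))   ≈⟨ +-congˡ (+-assoc 1# (- 1#) (- y)) ⟨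
      x + ((1# + - 1#) + - y)   ≈⟨ +-congˡ (+-congʳ (-‿inverseʳ 1#)) ⟩
      x + (0# + - y)            ≈⟨ +-congˡ (+-identityˡ (- y)) ⟩
      x - y                     ∎

    fromℤ-⊖ : ∀ m n → fromℤ (m ⊖ n) ≈ m × 1# - n × 1#
    fromℤ-⊖ m       zero    = sym (trans (+-congˡ -0#≈0#) (+-identityʳ _))
    fromℤ-⊖ zero    (suc n) = sym (+-identityˡ _)
    fromℤ-⊖ (suc m) (suc n) = begin
      fromℤ (suc m ⊖ suc n)      ≡⟨ ≡.cong fromℤ (ℤ.[1+m]⊖[1+n]≡m⊖n m n) ⟩
      fromℤ (m ⊖ n)              ≈⟨ fromℤ-⊖ m n ⟩
      m × 1# - n × 1#            ≈⟨ [1+x]-[1+y]≈x-y _ _ ⟨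
      suc m × 1# - suc n × 1#    ∎

    fromℤ-+ : ∀ i j → fromℤ (i ℤ.+ j) ≈ fromℤ i + fromℤ j
    fromℤ-+ (+ m)    (+ n)    = ×-homo-+ 1# m n
    fromℤ-+ (+ m)    -[1+ n ] = fromℤ-⊖ m (suc n)
    fromℤ-+ -[1+ m ] (+ n)    = trans (fromℤ-⊖ n (suc m)) (+-comm _ _)
    fromℤ-+ -[1+ m ] -[1+ n ] = begin
      - (suc (suc (m ℕ.+ n)) × 1#)        ≡⟨ ≡.cong (λ k → - (suc k × 1#)) (ℕ.+-suc m n) ⟨
      - ((suc m ℕ.+ suc n) × 1#)          ≈⟨ -‿cong (×-homo-+ 1# (suc m) (suc n)) ⟩
      - (suc m × 1# + suc n × 1#)         ≈⟨ -‿+-comm _ _ ⟨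
      - (suc m × 1#) + - (suc n × 1#)     ∎

    fromSign : Sign → Carrier
    fromSign Sign.+ = 1#
    fromSign Sign.- = - 1#

    fromSign-* : ∀ s t → fromSign (s Sign.* t) ≈ fromSign s * fromSign t
    fromSign-* Sign.+ t       = sym (*-identityˡ (fromSign t))
    fromSign-* Sign.- Sign.+  = sym (*-identityʳ (- 1#))
    fromSign-* Sign.- Sign.-  = begin
      1#             ≈⟨ -‿involutive 1# ⟨
      - - 1#         ≈⟨ -1*x≈-x (- 1#) ⟨
      - 1# * - 1#    ∎

    fromℤ-◃ : ∀ s n → fromℤ (s ◃ n) ≈ fromSign s * (n × 1#)
    fromℤ-◃ s      zero    = sym (zeroʳ (fromSign s))
    fromℤ-◃ Sign.+ (suc n) = sym (*-identityˡ _)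
    fromℤ-◃ Sign.- (suc n) = sym (-1*x≈-x _)

    fromℤ≈sign*abs : ∀ i → fromℤ i ≈ fromSign (ℤ.sign i) * (ℤ.∣ i ∣ × 1#)
    fromℤ≈sign*abs (+ n)    = sym (*-identityˡ _)
    fromℤ≈sign*abs -[1+ n ] = sym (-1*x≈-x _)

    fromℤ-* : ∀ i j → fromℤ (i ℤ.* j) ≈ fromℤ i * fromℤ j
    fromℤ-* i j = begin
      fromℤ ((ℤ.sign i Sign.* ℤ.sign j) ◃ (ℤ.∣ i ∣ ℕ.* ℤ.∣ j ∣))
        ≈⟨ fromℤ-◃ (ℤ.sign i Sign.* ℤ.sign j) (ℤ.∣ i ∣ ℕ.* ℤ.∣ j ∣) ⟩
      fromSign (ℤ.sign i Sign.* ℤ.sign j) * ((ℤ.∣ i ∣ ℕ.* ℤ.∣ j ∣) × 1#)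
        ≈⟨ *-cong (fromSign-* (ℤ.sign i) (ℤ.sign j)) (×1-homo-* ℤ.∣ i ∣ ℤ.∣ j ∣) ⟩
      (fromSign (ℤ.sign i) * fromSign (ℤ.sign j)) * ((ℤ.∣ i ∣ × 1#) * (ℤ.∣ j ∣ × 1#))
        ≈⟨ interchange _ _ _ _ ⟩
      (fromSign (ℤ.sign i) * (ℤ.∣ i ∣ × 1#)) * (fromSign (ℤ.sign j) * (ℤ.∣ j ∣ × 1#))
        ≈⟨ *-cong (fromℤ≈sign*abs i) (fromℤ≈sign*abs j) ⟨
      fromℤ i * fromℤ j
        ∎

    fromℤ-neg : ∀ i → fromℤ (ℤ.- i) ≈ - fromℤ i
    fromℤ-neg (+ zero)  = sym -0#≈0#
    fromℤ-neg (+ suc n) = refl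
    fromℤ-neg -[1+ n ]  = sym (-‿involutive _)

    homomorphism : ℤ.+-*-rawRing -Raw-AlmostCommutative⟶ fromCommutativeRing R
    homomorphism = record
      { ⟦_⟧ = fromℤ ; +-homo = fromℤ-+ ; *-homo = fromℤ-* ; -‿homo = fromℤ-neg
      ; 0-homo = refl ; 1-homo = +-identityʳ 1# }

    fromℤ-dec : ∀ i j → Maybe (fromℤ i ≈ fromℤ j)
    fromℤ-dec i j with i ℤ.≟ j
    ... | yes ≡.refl = just refl
    ... | no _       = nothing

  open import Algebra.Solver.Ring ℤ.+-*-rawRing (fromCommutativeRing R) homomorphism fromℤ-dec public
    using (solve; _:=_; _:+_; _:*_; _:-_; :-_; con)

module IndexArithmetic where

  i+1-1≡i : ∀ i → i +ℤ + 1 -ℤ + 1 ≡ i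
  i+1-1≡i = solve-∀

  i-1+1≡i : ∀ i → i -ℤ + 1 +ℤ + 1 ≡ i
  i-1+1≡i = solve-∀

  i+2-1≡i+1 : ∀ i → i +ℤ + 1 +ℤ + 1 -ℤ + 1 ≡ i +ℤ + 1
  i+2-1≡i+1 = solve-∀

  i+2-2≡i : ∀ i → i +ℤ + 1 +ℤ + 1 -ℤ + 2 ≡ i
  i+2-2≡i = solve-∀

  i+1+k≡i+k+1 : ∀ i k → i +ℤ + 1 +ℤ k ≡ i +ℤ k +ℤ + 1
  i+1+k≡i+k+1 = solve-∀

  i+[k+1]≡i+k+1 : ∀ i k → i +ℤ (k +ℤ + 1) ≡ i +ℤ k +ℤ + 1
  i+[k+1]≡i+k+1 = solve-∀

  i+0≡i : ∀ i → i +ℤ + 0 ≡ i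
  i+0≡i = solve-∀

  i+[k-i]≡k : ∀ i k → i +ℤ (k -ℤ i) ≡ k
  i+[k-i]≡k = solve-∀

  j+[k-i]≡k+j-i : ∀ i j k → j +ℤ (k -ℤ i) ≡ k +ℤ j -ℤ i
  j+[k-i]≡k+j-i = solve-∀

  t-a≡t-[a+1]+1 : ∀ t a → t -ℤ a ≡ t -ℤ (a +ℤ + 1) +ℤ + 1
  t-a≡t-[a+1]+1 = solve-∀

  i-0≡i : ∀ i → i -ℤ + 0 ≡ i
  i-0≡i = solve-∀

  i-1-1≡i-2 : ∀ i → i -ℤ + 1 -ℤ + 1 ≡ i -ℤ + 2
  i-1-1≡i-2 = solve-∀

  i+j-1-i≡j-1 : ∀ i j → i +ℤ j -ℤ + 1 -ℤ i ≡ j -ℤ + 1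
  i+j-1-i≡j-1 = solve-∀

ℤ-induction : ∀ {p} (P : ℤ → Set p) → P (+ 0) →
              (∀ n → P n → P (n +ℤ + 1)) → (∀ n → P (n +ℤ + 1) → P n) → ∀ n → P n
ℤ-induction P P0 up down (+ zero)     = P0
ℤ-induction P P0 up down (+ suc m)    =
  ≡.subst P (≡.cong +_ (ℕ.+-comm m 1)) (up (+ m) (ℤ-induction P P0 up down (+ m)))
ℤ-induction P P0 up down -[1+ zero ]  = down -[1+ zero ] P0
ℤ-induction P P0 up down -[1+ suc m ] = down -[1+ suc m ] (ℤ-induction P P0 up down -[1+ m ])

module Gibonacci {c ℓ} (R : CommutativeRing c ℓ) where
  open CommutativeRing R
  open import Algebra.Properties.Ring ring using (-‿involutive; -‿distribˡ-*)
  open import Algebra.Properties.CommutativeSemigroup +-commutativeSemigroup using (interchange)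
  open import Relation.Binary.Reasoning.Setoid setoid
  open IntegerCoefficients R
  open IndexArithmetic

  index-cong : ∀ (f : ℤ → Carrier) {i j} → i ≡ j → f i ≈ f j
  index-cong f i≡j = reflexive (≡.cong f i≡j)

  negOnePow-+suc : ∀ m → negOnePow R (+ suc m) ≈ - negOnePow R (+ m)
  negOnePow-+suc zero          = refl
  negOnePow-+suc (suc zero)    = sym (-‿involutive 1#)
  negOnePow-+suc (suc (suc m)) = negOnePow-+suc m

  -- negOnePow only inspects ∣ n ∣, so negOnePow R -[1+ m ] is definitionally negOnePow R (+ suc m).
  negOnePow-suc : ∀ n → negOnePow R (n +ℤ + 1) ≈ - negOnePow R n
  negOnePow-suc (+ m)        = trans (index-cong (negOnePow R) (≡.cong +_ (ℕ.+-comm m 1))) (negOnePow-+suc m)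
  negOnePow-suc -[1+ zero ]  = sym (-‿involutive 1#)
  negOnePow-suc -[1+ suc m ] = trans (sym (-‿involutive _)) (-‿cong (sym (negOnePow-+suc (suc m))))

  antiperiodic⇒alternating : (Φ : ℤ → Carrier) → (∀ n → Φ (n +ℤ + 1) ≈ - Φ n) →
                             ∀ n → Φ n ≈ negOnePow R n * Φ (+ 0)
  antiperiodic⇒alternating Φ anti = ℤ-induction P (sym (*-identityˡ _)) up down
    where
    P : ℤ → Set ℓ
    P n = Φ n ≈ negOnePow R n * Φ (+ 0)
    up : ∀ n → P n → P (n +ℤ + 1)
    up n Pn = begin
      Φ (n +ℤ + 1)                          ≈⟨ anti n ⟩
      - Φ n                                 ≈⟨ -‿cong Pn ⟩
      - (negOnePow R n * Φ (+ 0))           ≈⟨ -‿distribˡ-* _ _ ⟩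
      - negOnePow R n * Φ (+ 0)             ≈⟨ *-congʳ (negOnePow-suc n) ⟨
      negOnePow R (n +ℤ + 1) * Φ (+ 0)      ∎
    down : ∀ n → P (n +ℤ + 1) → P n
    down n Pn+1 = begin
      Φ n                                   ≈⟨ -‿involutive _ ⟨
      - - Φ n                               ≈⟨ -‿cong (anti n) ⟨
      - Φ (n +ℤ + 1)                        ≈⟨ -‿cong Pn+1 ⟩
      - (negOnePow R (n +ℤ + 1) * Φ (+ 0))  ≈⟨ -‿cong (*-congʳ (negOnePow-suc n)) ⟩
      - (- negOnePow R n * Φ (+ 0))         ≈⟨ -‿cong (-‿distribˡ-* _ _) ⟨
      - - (negOnePow R n * Φ (+ 0))         ≈⟨ -‿involutive _ ⟩
      negOnePow R n * Φ (+ 0)               ∎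

  periodic⇒constant : (Φ : ℤ → Carrier) → (∀ n → Φ (n +ℤ + 1) ≈ Φ n) → ∀ n → Φ n ≈ Φ (+ 0)
  periodic⇒constant Φ per = ℤ-induction (λ n → Φ n ≈ Φ (+ 0)) refl
    (λ n Φn≈Φ0 → trans (per n) Φn≈Φ0) (λ n Φn+1≈Φ0 → trans (sym (per n)) Φn+1≈Φ0)

  Recurrent : (ℤ → Carrier) → Set ℓ
  Recurrent f = ∀ j → f (j +ℤ + 1 +ℤ + 1) ≈ f (j +ℤ + 1) + f j

  isGibonacci⇒recurrent : ∀ {f} → IsGibonacci R f → Recurrent f
  isGibonacci⇒recurrent {f} gib j = begin
    f (j +ℤ + 1 +ℤ + 1)                                        ≈⟨ proj₂ gib _ ⟩
    f (j +ℤ + 1 +ℤ + 1 -ℤ + 1) + f (j +ℤ + 1 +ℤ + 1 -ℤ + 2)    ≈⟨ +-cong (index-cong f (i+2-1≡i+1 j)) (index-cong f (i+2-2≡i j)) ⟩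
    f (j +ℤ + 1) + f j                                         ∎

  recurrent-pred : ∀ {f} → Recurrent f → ∀ j → f (j -ℤ + 1) ≈ f (j +ℤ + 1) - f j
  recurrent-pred {f} rec j = begin
    f (j -ℤ + 1)                              ≈⟨ solve 2 (λ x y → (x :+ y) :- x := y) refl (f j) _ ⟨
    f j + f (j -ℤ + 1) - f j                  ≈⟨ +-congʳ (+-congʳ (index-cong f (i-1+1≡i j))) ⟨
    f (j -ℤ + 1 +ℤ + 1) + f (j -ℤ + 1) - f j  ≈⟨ +-congʳ (rec (j -ℤ + 1)) ⟨
    f (j -ℤ + 1 +ℤ + 1 +ℤ + 1) - f j          ≈⟨ +-congʳ (index-cong f (≡.cong (_+ℤ + 1) (i-1+1≡i j))) ⟩
    f (j +ℤ + 1) - f j                        ∎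

  recurrent-shift : ∀ {f} → Recurrent f → ∀ k → Recurrent (λ j → f (j +ℤ k))
  recurrent-shift {f} rec k j = begin
    f (j +ℤ + 1 +ℤ + 1 +ℤ k)         ≈⟨ index-cong f (i+1+k≡i+k+1 (j +ℤ + 1) k) ⟩
    f (j +ℤ + 1 +ℤ k +ℤ + 1)         ≈⟨ index-cong f (≡.cong (_+ℤ + 1) (i+1+k≡i+k+1 j k)) ⟩
    f (j +ℤ k +ℤ + 1 +ℤ + 1)         ≈⟨ rec (j +ℤ k) ⟩
    f (j +ℤ k +ℤ + 1) + f (j +ℤ k)   ≈⟨ +-congʳ (index-cong f (i+1+k≡i+k+1 j k)) ⟨
    f (j +ℤ + 1 +ℤ k) + f (j +ℤ k)   ∎

  recurrent-+ : ∀ {f g} → Recurrent f → Recurrent g → Recurrent (λ j → f j + g j)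
  recurrent-+ f-rec g-rec j = trans (+-cong (f-rec j) (g-rec j)) (interchange _ _ _ _)

  lucas : (ℤ → Carrier) → ℤ → Carrier
  lucas f j = f (j +ℤ + 1) + f (j -ℤ + 1)

  lucas-recurrent : ∀ {f} → Recurrent f → Recurrent (lucas f)
  lucas-recurrent rec = recurrent-+ (recurrent-shift rec (+ 1)) (recurrent-shift rec -[1+ 0 ])

  module _ {f} (rec : Recurrent f) (j : ℤ) where

    lucas-local : lucas f j ≈ f (j +ℤ + 1) + (f (j +ℤ + 1) - f j)
    lucas-local = +-congˡ (recurrent-pred rec j)

    lucas-local-suc : lucas f (j +ℤ + 1) ≈ (f (j +ℤ + 1) + f j) + f j
    lucas-local-suc = +-cong (rec j) (index-cong f (i+1-1≡i j))

    lucas-local-pred : lucas f (j -ℤ + 1) ≈ f j + (f j - (f (j +ℤ + 1) - f j))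
    lucas-local-pred = +-cong (index-cong f (i-1+1≡i j)) (begin
      f (j -ℤ + 1 -ℤ + 1)              ≈⟨ recurrent-pred rec (j -ℤ + 1) ⟩
      f (j -ℤ + 1 +ℤ + 1) - f (j -ℤ + 1) ≈⟨ +-cong (index-cong f (i-1+1≡i j)) (-‿cong (recurrent-pred rec j)) ⟩
      f j - (f (j +ℤ + 1) - f j)         ∎)

  antidiagonal : (f g : ℤ → Carrier) → ℤ → ℤ → Carrier
  antidiagonal f g t a = f a * g (t -ℤ a) + f (a +ℤ + 1) * g (t -ℤ a +ℤ + 1)

  antidiagonal-constant : ∀ {f g} → Recurrent f → Recurrent g →
                          ∀ t a → antidiagonal f g t a ≈ antidiagonal f g t (+ 0)
  antidiagonal-constant {f} {g} f-rec g-rec t = periodic⇒constant (antidiagonal f g t) step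
    where
    step : ∀ a → antidiagonal f g t (a +ℤ + 1) ≈ antidiagonal f g t a
    step a = begin
      f (a +ℤ + 1) * g p + f (a +ℤ + 1 +ℤ + 1) * g (p +ℤ + 1)
        ≈⟨ +-congˡ (*-congʳ (f-rec a)) ⟩
      f (a +ℤ + 1) * g p + (f (a +ℤ + 1) + f a) * g (p +ℤ + 1)
        ≈⟨ solve 4 (λ x y u v → x :* u :+ (x :+ y) :* v := y :* v :+ x :* (v :+ u)) refl _ _ _ _ ⟩
      f a * g (p +ℤ + 1) + f (a +ℤ + 1) * (g (p +ℤ + 1) + g p)
        ≈⟨ +-cong (*-congˡ (index-cong g t-a≡p+1)) (*-congˡ (trans (index-cong g (≡.cong (_+ℤ + 1) t-a≡p+1)) (g-rec p))) ⟨
      f a * g (t -ℤ a) + f (a +ℤ + 1) * g (t -ℤ a +ℤ + 1)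
        ∎
      where
      p : ℤ
      p = t -ℤ (a +ℤ + 1)
      t-a≡p+1 : t -ℤ a ≡ p +ℤ + 1
      t-a≡p+1 = t-a≡t-[a+1]+1 t a

  -- With x = (lucas G j + G j √5)/2 and y = (lucas H m + H m √5)/2 this is −2 (x ȳ + x̄ y), a polarised
  -- norm form of ℚ(√5). Raising j and m multiplies x and y by the golden ratio, of norm −1.
  polarNorm : (G H : ℤ → Carrier) → ℤ → ℤ → Carrier
  polarNorm G H j m = nat R 5 * G j * H m - lucas G j * lucas H m

  module _ {G H} (G-rec : Recurrent G) (H-rec : Recurrent H) where

    polarNorm-shift : ∀ j m → polarNorm G H (j +ℤ + 1) (m +ℤ + 1) ≈ - polarNorm G H j m
    polarNorm-shift j m = begin
      polarNorm G H (j +ℤ + 1) (m +ℤ + 1)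
        ≈⟨ +-congˡ (-‿cong (*-cong (lucas-local-suc G-rec j) (lucas-local-suc H-rec m))) ⟩
      nat R 5 * g₁ * h₁ - ((g₁ + g₀) + g₀) * ((h₁ + h₀) + h₀)
        ≈⟨ solve 4 (λ g₀ g₁ h₀ h₁ →
             con (+ 5) :* g₁ :* h₁ :- ((g₁ :+ g₀) :+ g₀) :* ((h₁ :+ h₀) :+ h₀)
             := :- (con (+ 5) :* g₀ :* h₀ :- (g₁ :+ (g₁ :- g₀)) :* (h₁ :+ (h₁ :- h₀)))) refl g₀ g₁ h₀ h₁ ⟩
      - (nat R 5 * g₀ * h₀ - (g₁ + (g₁ - g₀)) * (h₁ + (h₁ - h₀)))
        ≈⟨ -‿cong (+-congˡ (-‿cong (*-cong (lucas-local G-rec j) (lucas-local H-rec m)))) ⟨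
      - polarNorm G H j m
        ∎
      where
      g₀ g₁ h₀ h₁ : Carrier
      g₀ = G j
      g₁ = G (j +ℤ + 1)
      h₀ = H m
      h₁ = H (m +ℤ + 1)

    polarNorm-diagonal : ∀ k r s → polarNorm G H k (k +ℤ s -ℤ r) ≈ negOnePow R (k -ℤ r) * polarNorm G H r s
    polarNorm-diagonal k r s = begin
      polarNorm G H k (k +ℤ s -ℤ r)
        ≡⟨ ≡.cong₂ (polarNorm G H) (i+[k-i]≡k r k) (j+[k-i]≡k+j-i r s k) ⟨
      Φ (k -ℤ r)
        ≈⟨ antiperiodic⇒alternating Φ Φ-anti (k -ℤ r) ⟩
      negOnePow R (k -ℤ r) * Φ (+ 0)
        ≡⟨ ≡.cong₂ (λ i j → negOnePow R (k -ℤ r) * polarNorm G H i j) (i+0≡i r) (i+0≡i s) ⟩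
      negOnePow R (k -ℤ r) * polarNorm G H r s
        ∎
      where
      Φ : ℤ → Carrier
      Φ n = polarNorm G H (r +ℤ n) (s +ℤ n)
      Φ-anti : ∀ n → Φ (n +ℤ + 1) ≈ - Φ n
      Φ-anti n = trans (reflexive (≡.cong₂ (polarNorm G H) (i+[k+1]≡i+k+1 r n) (i+[k+1]≡i+k+1 s n)))
                       (polarNorm-shift (r +ℤ n) (s +ℤ n))

    polarNorm-antidiagonal : ∀ r s → polarNorm G H r s ≈
      nat R 2 * (G r * lucas H (s -ℤ + 1) + G (r +ℤ + 1) * lucas H s) - nat R 2 * (lucas G r * lucas H s)
    polarNorm-antidiagonal r s = begin
      polarNorm G H r s
        ≈⟨ +-congˡ (-‿cong (*-cong (lucas-local G-rec r) (lucas-local H-rec s))) ⟩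
      nat R 5 * g₀ * h₀ - (g₁ + (g₁ - g₀)) * (h₁ + (h₁ - h₀))
        ≈⟨ solve 4 (λ g₀ g₁ h₀ h₁ →
             con (+ 5) :* g₀ :* h₀ :- (g₁ :+ (g₁ :- g₀)) :* (h₁ :+ (h₁ :- h₀))
             := con (+ 2) :* (g₀ :* (h₀ :+ (h₀ :- (h₁ :- h₀))) :+ g₁ :* (h₁ :+ (h₁ :- h₀)))
                :- con (+ 2) :* ((g₁ :+ (g₁ :- g₀)) :* (h₁ :+ (h₁ :- h₀)))) refl g₀ g₁ h₀ h₁ ⟩
      nat R 2 * (g₀ * (h₀ + (h₀ - (h₁ - h₀))) + g₁ * (h₁ + (h₁ - h₀))) - nat R 2 * ((g₁ + (g₁ - g₀)) * (h₁ + (h₁ - h₀)))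
        ≈⟨ +-cong (*-congˡ (+-cong (*-congˡ (lucas-local-pred H-rec s)) (*-congˡ (lucas-local H-rec s))))
                  (-‿cong (*-congˡ (*-cong (lucas-local G-rec r) (lucas-local H-rec s)))) ⟨
      nat R 2 * (G r * lucas H (s -ℤ + 1) + G (r +ℤ + 1) * lucas H s) - nat R 2 * (lucas G r * lucas H s)
        ∎
      where
      g₀ g₁ h₀ h₁ : Carrier
      g₀ = G r
      g₁ = G (r +ℤ + 1)
      h₀ = H s
      h₁ = H (s +ℤ + 1)

    lucas-antidiagonal-to-seeds : ∀ r s →
      G r * lucas H (s -ℤ + 1) + G (r +ℤ + 1) * lucas H s ≈
      G (+ 0) * (H (r +ℤ s) + H (r +ℤ s -ℤ + 2)) + G (+ 1) * lucas H (r +ℤ s)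
    lucas-antidiagonal-to-seeds r s = begin
      G r * X (s -ℤ + 1) + G (r +ℤ + 1) * X s
        ≈⟨ +-cong (*-congˡ (index-cong X t-r≡s-1)) (*-congˡ (index-cong X (≡.trans (≡.cong (_+ℤ + 1) t-r≡s-1) (i-1+1≡i s)))) ⟨
      G r * X (t -ℤ r) + G (r +ℤ + 1) * X (t -ℤ r +ℤ + 1)
        ≈⟨ antidiagonal-constant G-rec (lucas-recurrent H-rec) t r ⟩
      G (+ 0) * X (t -ℤ + 0) + G (+ 1) * X (t -ℤ + 0 +ℤ + 1)
        ≈⟨ +-cong (*-congˡ (index-cong X (i-0≡i t))) (*-congˡ (index-cong X (≡.cong (_+ℤ + 1) (i-0≡i t)))) ⟩
      G (+ 0) * X t + G (+ 1) * X (t +ℤ + 1)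
        ≈⟨ +-cong (*-congˡ (+-cong (index-cong H (i-1+1≡i (r +ℤ s))) (index-cong H (i-1-1≡i-2 (r +ℤ s)))))
                  (*-congˡ (index-cong X (i-1+1≡i (r +ℤ s)))) ⟩
      G (+ 0) * (H (r +ℤ s) + H (r +ℤ s -ℤ + 2)) + G (+ 1) * X (r +ℤ s)
        ∎
      where
      X : ℤ → Carrier
      X = lucas H
      t : ℤ
      t = r +ℤ s -ℤ + 1
      t-r≡s-1 : t -ℤ r ≡ s -ℤ + 1
      t-r≡s-1 = i+j-1-i≡j-1 r s

proposition14 : {c ℓ : Level} (R : CommutativeRing c ℓ) →
    let open CommutativeRing R in
    (G H : ℤ → Carrier) → IsGibonacci R G → IsGibonacci R H →
    (k r s : ℤ) →
    (nat R 5 * G k * H (k +ℤ s -ℤ r))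
      - ((G (k +ℤ + 1) + G (k -ℤ + 1)) * (H (k +ℤ s -ℤ r +ℤ + 1) + H (k +ℤ s -ℤ r -ℤ + 1)))
    ≈
    (negOnePow R (k -ℤ r +ℤ + 1) * nat R 2 * (G (r +ℤ + 1) + G (r -ℤ + 1)) * (H (s +ℤ + 1) + H (s -ℤ + 1)))
      + (negOnePow R (k -ℤ r) * nat R 2
          * ((G (+ 0) * (H (r +ℤ s) + H (r +ℤ s -ℤ + 2))) + (G (+ 1) * (H (r +ℤ s +ℤ + 1) + H (r +ℤ s -ℤ + 1)))))
proposition14 R G H G-gib H-gib k r s = begin
  polarNorm G H k (k +ℤ s -ℤ r)
    ≈⟨ polarNorm-diagonal G-rec H-rec k r s ⟩
  ε * polarNorm G H r s
    ≈⟨ *-congˡ (polarNorm-antidiagonal G-rec H-rec r s) ⟩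
  ε * (nat R 2 * (G r * lucas H (s -ℤ + 1) + G (r +ℤ + 1) * lucas H s) - nat R 2 * (lucas G r * lucas H s))
    ≈⟨ *-congˡ (+-congʳ (*-congˡ (lucas-antidiagonal-to-seeds G-rec H-rec r s))) ⟩
  ε * (nat R 2 * T - nat R 2 * (lucas G r * lucas H s))
    ≈⟨ solve 4 (λ e t x y → e :* (con (+ 2) :* t :- con (+ 2) :* (x :* y))
                          := (:- e) :* con (+ 2) :* x :* y :+ e :* con (+ 2) :* t) refl ε T (lucas G r) (lucas H s) ⟩
  - ε * nat R 2 * lucas G r * lucas H s + ε * nat R 2 * T
    ≈⟨ +-congʳ (*-congʳ (*-congʳ (*-congʳ (negOnePow-suc (k -ℤ r))))) ⟨
  negOnePow R (k -ℤ r +ℤ + 1) * nat R 2 * lucas G r * lucas H s + ε * nat R 2 * T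
    ∎
  where
  open CommutativeRing R
  open Gibonacci R
  open IntegerCoefficients R using (solve; _:=_; _:+_; _:*_; _:-_; :-_; con)
  open import Relation.Binary.Reasoning.Setoid setoid
  G-rec : Recurrent G
  G-rec = isGibonacci⇒recurrent G-gib
  H-rec : Recurrent H
  H-rec = isGibonacci⇒recurrent H-gib
  ε : Carrier
  ε = negOnePow R (k -ℤ r)
  T : Carrier
  T = G (+ 0) * (H (r +ℤ s) + H (r +ℤ s -ℤ + 2)) + G (+ 1) * lucas H (r +ℤ s)
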